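{- Let $K$ be an $n$-vertex polyhedral map on a surface, let $M$ be its dual map, and let $T$ be a proper tree in $M$ with $k$ vertices. Let $D$ be the subcomplex of $K$ dual to $T$, i.e. the union of the $k$ facets of $K$ corresponding to the vertices of $T$. Then $D$ is a 2-disk and its boundary $\partial D$ is a Hamiltonian cycle in $EG(K)$.
   Context: A surface is a connected compact 2-manifold without boundary. A map on a surface is an embedding of a finite simple graph whose complementary components have closures that are polygonal 2-disks (facets/faces, each with at least 3 sides); it is polyhedral if any two facets meet in the empty set, a vertex, or an edge. The dual map $M$ of $K$ has the facets of $K$ as vertices, two joined iff the facets share an edge; faces of $M$ correspond to vertices of $K$. $EG(\cdot)$ denotes the edge graph. A tree $T$ in $EG(M)$ with vertex set $\{v_1,\dots,v_k\}$ is a proper tree if: (1) $\sum_{i=1}^k\deg(v_i)=n+2(k-1)$ (degrees in $EG(M)$); (2) whenever two vertices $u_1,u_2$ of $T$ lie on a face $F$ of $M$, a path joining them in $\partial F$ is part of $T$; (3) every path in $T$ lying in a face $F$ of $M$ has length at most $q-2$, where $q$ is the length of $\partial F$. -}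

module Defs where

open import Data.Nat using (ℕ; zero; suc; _+_; _*_; _∸_; _≤_; _<_)
open import Data.Fin using (Fin; toℕ)
open import Data.List using (List; []; _∷_; _++_; [_]; length; map; head; last)
open import Data.Nat.ListAction using (sum)
open import Data.Empty using (⊥)
open import Data.List.Membership.Propositional using (_∈_)
open import Data.List.Relation.Unary.Unique.Propositional using (Unique)
open import Data.Maybe using (just)
open import Data.Product using (Σ; _×_; _,_; ∃; ∃-syntax)
open import Data.Sum using (_⊎_)
open import Relation.Nullary using (¬_)
open import Relation.Binary.PropositionalEquality using (_≡_; _≢_)
open import Function.Bundles using (_⇔_)

pairs : {A : Set} → List A → List (A × A)
pairs (a ∷ b ∷ t) = (a , b) ∷ pairs (b ∷ t)
pairs _           = []

cycPairs : {A : Set} → List A → List (A × A)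
cycPairs []       = []
cycPairs (x ∷ xs) = pairs (x ∷ xs ++ [ x ])

CycEdge : {A : Set} → List A → A → A → Set
CycEdge xs u v = ((u , v) ∈ cycPairs xs) ⊎ ((v , u) ∈ cycPairs xs)

data Chain {A : Set} (R : A → A → Set) : List A → Set where
  nil  : Chain R []
  one  : ∀ {a} → Chain R (a ∷ [])
  cons : ∀ {a b t} → R a b → Chain R (b ∷ t) → Chain R (a ∷ b ∷ t)

Ends : {A : Set} → List A → A → A → Set
Ends xs a b = (head xs ≡ just a) × (last xs ≡ just b)

PathIn : {A : Set} → (A → A → Set) → A → A → List A → Set
PathIn R a b xs = Unique xs × Chain R xs × Ends xs a b

Connected : {A : Set} → (A → A → Set) → A → A → Set
Connected R a b = ∃[ xs ] (Chain R xs × Ends xs a b)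

IsCycle : {A : Set} → (A → A → Set) → List A → Set
IsCycle R cs = (3 ≤ length cs) × Unique cs × (∀ u v → CycEdge cs u v → R u v)

Count : {A : Set} → (A → Set) → ℕ → Set
Count {A} P c = Σ (List A) λ xs → Unique xs × (∀ a → (a ∈ xs) ⇔ P a) × (length xs ≡ c)

-- Combinatorial maps.
-- A map K with vertex set Fin n and f facets; facet i is given by its
-- boundary cycle  face i  (a cyclic list of vertices).

module Map {n f : ℕ} (face : Fin f → List (Fin n)) where

  FEdge : Fin f → Fin n → Fin n → Set
  FEdge i u v = CycEdge (face i) u v

  EGK : Fin n → Fin n → Set
  EGK u v = ∃[ i ] FEdge i u v

  -- edge graph of the dual map M: facets sharing an edge
  AdjM : Fin f → Fin f → Set
  AdjM i j = (i ≢ j) × (∃[ u ] ∃[ v ] (FEdge i u v × FEdge j u v))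

  -- adjacency along the boundary cycle of the face F_v of M dual to vertex v:
  -- two facets meeting along an edge of K through v
  LinkAdj : Fin n → Fin f → Fin f → Set
  LinkAdj v i j = (i ≢ j) × (∃[ w ] (FEdge i v w × FEdge j v w))

  record IsPolyhedralMap : Set where
    field
      facetPolygon  : ∀ i → 3 ≤ length (face i) × Unique (face i)
      vertexCovered : ∀ v → ∃[ i ] (v ∈ face i)
      edgeTwo       : ∀ i u v → FEdge i u v → ∃[ j ] ((j ≢ i) × FEdge j u v)
      edgeAtMostTwo : ∀ i j l u v → FEdge i u v → FEdge j u v → FEdge l u v →
                        (i ≡ j) ⊎ (j ≡ l) ⊎ (i ≡ l)
      -- the link of every vertex is connected (hence a single cycle):
      -- the facets around v form one cycle
      linkConnected : ∀ v i j → v ∈ face i → v ∈ face j → Connected (LinkAdj v) i j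
      connected     : ∀ i j → Connected AdjM i j
      -- polyhedrality: two distinct facets meet in ∅, a vertex or an edge
      meetEdge      : ∀ i j → i ≢ j → ∀ u v → u ∈ face i → u ∈ face j →
                        v ∈ face i → v ∈ face j → u ≢ v → FEdge i u v × FEdge j u v
      meetNoThree   : ∀ i j → i ≢ j → ∀ u v w → u ∈ face i → u ∈ face j →
                        v ∈ face i → v ∈ face j → w ∈ face i → w ∈ face j →
                        u ≢ v → v ≢ w → u ≢ w → ⊥

  record IsTreeInM (vs : List (Fin f)) (es : List (Fin f × Fin f)) : Set where
    field
      nonempty  : 1 ≤ length vs
      distinct  : Unique vs
      edgesOk   : ∀ a b → (a , b) ∈ es → (a ∈ vs) × (b ∈ vs) × AdjM a b
      connected : ∀ a b → a ∈ vs → b ∈ vs →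
                    Connected (λ x y → ((x , y) ∈ es) ⊎ ((y , x) ∈ es)) a b
      acyclic   : ∀ cs → ¬ IsCycle (λ x y → ((x , y) ∈ es) ⊎ ((y , x) ∈ es)) cs

  TEdge : List (Fin f × Fin f) → Fin f → Fin f → Set
  TEdge es x y = ((x , y) ∈ es) ⊎ ((y , x) ∈ es)

  -- proper tree (deg i = degree of i in EG(M), k = length vs)
  record IsProperTree (deg : Fin f → ℕ) (vs : List (Fin f)) (es : List (Fin f × Fin f)) : Set where
    field
      tree  : IsTreeInM vs es
      cond1 : sum (map deg vs) ≡ n + 2 * (length vs ∸ 1)
      cond2 : ∀ v u₁ u₂ → u₁ ∈ vs → u₂ ∈ vs → v ∈ face u₁ → v ∈ face u₂ →
                ∃[ xs ] PathIn (λ x y → TEdge es x y × LinkAdj v x y) u₁ u₂ xs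
      cond3 : ∀ v q → Count (λ i → v ∈ face i) q → ∀ xs →
                Unique xs → Chain (λ x y → TEdge es x y × LinkAdj v x y) xs →
                (∀ x → x ∈ xs → v ∈ face x) →
                length xs ∸ 1 ≤ q ∸ 2

  module Sub (vs : List (Fin f)) where

    DVertex : Fin n → Set
    DVertex u = ∃[ i ] ((i ∈ vs) × (u ∈ face i))

    DEdgeOrd : Fin n × Fin n → Set
    DEdgeOrd (u , v) = (toℕ u < toℕ v) × (∃[ i ] ((i ∈ vs) × FEdge i u v))

    BdEdge : Fin n → Fin n → Set
    BdEdge u v = ∃[ i ] ((i ∈ vs) × FEdge i u v ×
                         (∀ j → j ∈ vs → FEdge j u v → j ≡ i))

    -- D is a (combinatorial) 2-disk: a connected polygonal 2-manifold with
    -- nonempty boundary and Euler characteristic 1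
    record IsDisk : Set where
      field
        faceConnected : ∀ i j → i ∈ vs → j ∈ vs →
                          Connected (λ x y → (x ∈ vs) × (y ∈ vs) × AdjM x y) i j
        linkConnected : ∀ u i j → i ∈ vs → j ∈ vs → u ∈ face i → u ∈ face j →
                          Connected (λ x y → (x ∈ vs) × (y ∈ vs) × LinkAdj u x y) i j
        boundaryNonempty : ∃[ u ] ∃[ v ] BdEdge u v
        euler : ∃[ V ] ∃[ E ] (Count DVertex V × Count DEdgeOrd E ×
                                 (V + length vs ≡ E + 1))

    BoundaryHamiltonian : Set
    BoundaryHamiltonian =
      ∃[ cs ] (IsCycle EGK cs × (length cs ≡ n) ×
               (∀ u v → BdEdge u v ⇔ CycEdge cs u v))

-- The disk is built facet by facet along the tree T: starting from one facet, we repeatedly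
-- attach a facet F of T that is joined in T to an already used facet G, sharing with it an
-- edge xy. The invariant is that the used facets S form a disk all of whose vertices lie on
-- its boundary cycle. The new facet meets this disk only in x and y: a further common vertex w
-- is surrounded, by condition (2), by a path of T from F into S; that path must enter S through
-- the tree edge FG, for otherwise it closes a cycle of T, and then w, x, y would be three common
-- vertices of F and G, contradicting polyhedrality. So the new boundary is the old one with xy
-- replaced by the rest of the boundary of F, and V + F = E + 1 persists. A facet with q sides
-- lengthens the boundary by q − 2, and the degree of a facet in EG(M) is its number of sides, so
-- by condition (1) the final boundary has length Σ deg − 2(k − 1) = n and passes through every
-- vertex.

module Submission where

open import Defs

open import Data.Empty using (⊥; ⊥-elim)
open import Data.Fin using (Fin; toℕ)
import Data.Fin as Fin
open import Data.Fin.Properties using (toℕ-injective)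
open import Data.List
  using (List; []; _∷_; _++_; [_]; length; map; last; reverse; InitLast; _∷ʳ′_; initLast)
open import Data.List.Properties
  using ( map-cong; map-++; length-map; length-++; ++-assoc; ++-identityʳ; ∷ʳ-injective
        ; unfold-reverse; reverse-++; reverse-involutive)
open import Data.List.Membership.Propositional using (_∈_; _∉_)
open import Data.List.Membership.Propositional.Properties
  using (∈-++⁺ˡ; ∈-++⁺ʳ; ∈-++⁻; ∈-map⁺; ∈-map⁻; ∈-∃++)
open import Data.List.Membership.Propositional.Properties.WithK using (unique∧set⇒bag)
import Data.List.Membership.DecPropositional as DecMembership
open import Data.List.Relation.Unary.Any using (here; there)
open import Data.List.Relation.Unary.All using (All; []; _∷_)
import Data.List.Relation.Unary.All as All
import Data.List.Relation.Unary.All.Properties as All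
open import Data.List.Relation.Unary.AllPairs using ([]; _∷_)
import Data.List.Relation.Unary.AllPairs as AllPairs
open import Data.List.Relation.Unary.Unique.Propositional using (Unique)
open import Data.List.Relation.Unary.Unique.Propositional.Properties using (Unique[x∷xs]⇒x∉xs)
import Data.List.Relation.Unary.Unique.Propositional.Properties as Unique
open import Data.List.Relation.Binary.BagAndSetEquality using (∼bag⇒↭)
open import Data.List.Relation.Binary.Permutation.Propositional
  using (_↭_; ↭-refl; ↭-sym; ↭-trans; ↭-reflexive; ↭⇒↭ₛ; module PermutationReasoning)
open import Data.List.Relation.Binary.Permutation.Propositional.Properties
  using (++-comm; ∈-resp-↭; ↭-reverse; ↭-length; map⁺; shift; ++⁺ˡ)
import Data.List.Relation.Binary.Permutation.Setoid.Properties as PermSetoid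
open import Data.Maybe using (just)
open import Data.Nat using (ℕ; zero; suc; _+_; _*_; _∸_; _≤_; _<_; z≤n; s≤s)
import Data.Nat as ℕ
open import Data.Nat.ListAction using (sum)
open import Data.Nat.ListAction.Properties using (sum-↭)
open import Data.Nat.Properties
  using ( suc-injective; +-cancelʳ-≡; +-identityʳ; +-comm; m≤n+m; m≤m+n
        ; <-asym; <-irrefl; <-trans; <⇒≢; ≰⇒>; ≤∧≢⇒<; ≤-pred; ≤-antisym; ≤-trans)
open import Data.Nat.Tactic.RingSolver using (solve-∀)
open import Data.Product using (_×_; _,_; ∃-syntax; ∃₂; proj₁; proj₂; uncurry)
import Data.Product as Product
open import Data.Product.Properties using (,-injective; ≡-dec)
open import Data.Sum using (_⊎_; inj₁; inj₂)
import Data.Sum as Sum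
open import Function.Base using (_∘_; flip)
open import Function.Bundles using (_⇔_; mk⇔; Equivalence)
import Function.Properties.Equivalence as ⇔
open import Relation.Binary.PropositionalEquality
  using (_≡_; _≢_; refl; sym; trans; cong; cong₂; subst; subst₂; setoid; module ≡-Reasoning)
open import Relation.Nullary using (¬_; Dec; yes; no)
open import Relation.Nullary.Decidable using (_⊎-dec_)

private variable
  A B : Set
  a b u v w z : A
  xs ys : List A
  R : A → A → Set

pairs-∈ : (u , v) ∈ pairs xs → u ∈ xs × v ∈ xs
pairs-∈ {xs = _ ∷ _ ∷ _} (here refl) = here refl , there (here refl)
pairs-∈ {xs = _ ∷ _ ∷ _} (there p)   = Product.map there there (pairs-∈ p)

pairs-++ : (xs : List A) (a : A) (ys : List A) →
           pairs (xs ++ [ a ]) ++ pairs (a ∷ ys) ≡ pairs (xs ++ a ∷ ys)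
pairs-++ []          a ys = refl
pairs-++ (x ∷ [])    a ys = refl
pairs-++ (x ∷ y ∷ t) a ys = cong ((x , y) ∷_) (pairs-++ (y ∷ t) a ys)

pairs-∈⇒split : (a , b) ∈ pairs xs → ∃₂ λ P Q → xs ≡ P ++ a ∷ b ∷ Q
pairs-∈⇒split {xs = x ∷ y ∷ t} (here refl) = [] , t , refl
pairs-∈⇒split {xs = x ∷ y ∷ t} (there p) with pairs-∈⇒split p
... | P , Q , eq = x ∷ P , Q , cong (x ∷_) eq

pairs-reverse : (xs : List A) → (u , v) ∈ pairs xs → (v , u) ∈ pairs (reverse xs)
pairs-reverse (x ∷ y ∷ t) p = subst (_ ∈_) (sym pairs-rev) (step p)
  where
  pairs-rev : pairs (reverse (x ∷ y ∷ t)) ≡ pairs (reverse (y ∷ t)) ++ [ (y , x) ]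
  pairs-rev = begin
    pairs (reverse (x ∷ y ∷ t))             ≡⟨ cong pairs (unfold-reverse x (y ∷ t)) ⟩
    pairs (reverse (y ∷ t) ++ [ x ])        ≡⟨ cong (λ z → pairs (z ++ [ x ])) (unfold-reverse y t) ⟩
    pairs ((reverse t ++ [ y ]) ++ [ x ])   ≡⟨ cong pairs (++-assoc (reverse t) [ y ] [ x ]) ⟩
    pairs (reverse t ++ y ∷ [ x ])          ≡⟨ pairs-++ (reverse t) y [ x ] ⟨
    pairs (reverse t ++ [ y ]) ++ [ (y , x) ] ≡⟨ cong (λ z → pairs z ++ [ (y , x) ]) (unfold-reverse y t) ⟨
    pairs (reverse (y ∷ t)) ++ [ (y , x) ]  ∎
    where open ≡-Reasoning
  step : ∀ {u v} → (u , v) ∈ pairs (x ∷ y ∷ t) → (v , u) ∈ pairs (reverse (y ∷ t)) ++ [ (y , x) ]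
  step (here refl) = ∈-++⁺ʳ _ (here refl)
  step (there p)   = ∈-++⁺ˡ (pairs-reverse (y ∷ t) p)

length-pairs : (x : A) (ys : List A) → length (pairs (x ∷ ys)) ≡ length ys
length-pairs x []       = refl
length-pairs x (y ∷ ys) = cong suc (length-pairs y ys)

pairs-distinct : Unique xs → (u , v) ∈ pairs xs → u ≢ v
pairs-distinct {xs = _ ∷ _ ∷ _} ((x≢y ∷ _) ∷ _) (here refl) = x≢y
pairs-distinct {xs = _ ∷ _ ∷ _} (_ ∷ u)         (there p)   = pairs-distinct u p

pairs-interior : (x : A) (m : List A) (y : A) → m ≢ [] → (a , b) ∈ pairs (x ∷ m ++ [ y ]) →
                 (a ∈ m) ⊎ (b ∈ m)
pairs-interior x []            y m≢[] _                   = ⊥-elim (m≢[] refl)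
pairs-interior x (c ∷ m)       y _    (here refl)         = inj₂ (here refl)
pairs-interior x (c ∷ [])      y _    (there (here refl)) = inj₁ (here refl)
pairs-interior x (c ∷ d ∷ m)   y _    (there q)           =
  Sum.map there there (pairs-interior c (d ∷ m) y (λ ()) q)

PathEdge : List A → A → A → Set
PathEdge xs u v = ((u , v) ∈ pairs xs) ⊎ ((v , u) ∈ pairs xs)

SameEdge : A → A → A → A → Set
SameEdge u v a b = ((u ≡ a) × (v ≡ b)) ⊎ ((u ≡ b) × (v ≡ a))

SameEdge-swap : SameEdge u v a b → SameEdge u v b a
SameEdge-swap = Sum.swap

PathEdge-∈ : PathEdge xs u v → u ∈ xs × v ∈ xs
PathEdge-∈ (inj₁ p) = pairs-∈ p
PathEdge-∈ (inj₂ p) = Product.swap (pairs-∈ p)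

PathEdge-reverse : (xs : List A) → PathEdge xs u v → PathEdge (reverse xs) u v
PathEdge-reverse xs = Sum.swap ∘ Sum.map (pairs-reverse xs) (pairs-reverse xs)

PathEdge-reverse⁻ : (xs : List A) → PathEdge (reverse xs) u v → PathEdge xs u v
PathEdge-reverse⁻ xs e = subst (λ z → PathEdge z _ _) (reverse-involutive xs) (PathEdge-reverse (reverse xs) e)

PathEdge-distinct : Unique xs → PathEdge xs u v → u ≢ v
PathEdge-distinct u (inj₁ p) = pairs-distinct u p
PathEdge-distinct u (inj₂ p) = pairs-distinct u p ∘ sym

private
  pairs-through-head : {p c : A} {r : List A} → Unique (p ∷ c ∷ r) → (a , b) ∈ pairs (p ∷ c ∷ r) →
                       (a ≡ p) ⊎ (b ≡ p) → (a ≡ p) × (b ≡ c)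
  pairs-through-head u (here refl) _          = refl , refl
  pairs-through-head u (there q)   (inj₁ refl) = ⊥-elim (Unique[x∷xs]⇒x∉xs u (proj₁ (pairs-∈ q)))
  pairs-through-head u (there q)   (inj₂ refl) = ⊥-elim (Unique[x∷xs]⇒x∉xs u (proj₂ (pairs-∈ q)))

PathEdge-joining-ends : (p : A) (m : List A) (q : A) {u v : A} → Unique (p ∷ m ++ [ q ]) →
  PathEdge (p ∷ m ++ [ q ]) u v → (u ≡ p) ⊎ (u ≡ q) → (v ≡ p) ⊎ (v ≡ q) → m ≡ []
PathEdge-joining-ends p []       q _ _ _ _ = refl
PathEdge-joining-ends p (c ∷ m) q {u} {v} U e = λ hu hv → ⊥-elim (joins e hu hv)
  where
  c≢q : c ≢ q
  c≢q refl = Unique[x∷xs]⇒x∉xs (AllPairs.tail U) (∈-++⁺ʳ m (here refl))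
  u≢v : u ≢ v
  u≢v = PathEdge-distinct U e
  joins : PathEdge (p ∷ c ∷ m ++ [ q ]) u v → (u ≡ p) ⊎ (u ≡ q) → (v ≡ p) ⊎ (v ≡ q) → ⊥
  joins _        (inj₁ refl) (inj₁ refl) = u≢v refl
  joins _        (inj₂ refl) (inj₂ refl) = u≢v refl
  joins (inj₁ x) (inj₁ refl) (inj₂ refl) = c≢q (sym (proj₂ (pairs-through-head U x (inj₁ refl))))
  joins (inj₂ x) (inj₁ refl) (inj₂ refl) = u≢v (sym (proj₁ (pairs-through-head U x (inj₂ refl))))
  joins (inj₁ x) (inj₂ refl) (inj₁ refl) = u≢v (proj₁ (pairs-through-head U x (inj₂ refl)))
  joins (inj₂ x) (inj₂ refl) (inj₁ refl) = c≢q (sym (proj₂ (pairs-through-head U x (inj₁ refl))))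

length-∷ʳ : (xs : List A) (x : A) → length (xs ++ [ x ]) ≡ suc (length xs)
length-∷ʳ xs x = trans (length-++ xs) (+-comm (length xs) 1)

closedPath-form : (xs : List A) → 2 ≤ length xs → ∃[ x ] ∃[ m ] ∃[ y ] xs ≡ x ∷ m ++ [ y ]
closedPath-form (x ∷ ys) _ with initLast ys
closedPath-form (x ∷ .[]) (s≤s ()) | InitLast.[]
... | m ∷ʳ′ y = x , m , y , refl

length-closedPath : (a : A) (m : List A) (b : A) → length (a ∷ m ++ [ b ]) ≡ length m + 2
length-closedPath a m b = trans (cong suc (length-∷ʳ m b)) (+-comm 2 (length m))

rev-closedPath : (a : A) (m : List A) (b : A) → reverse (a ∷ m ++ [ b ]) ≡ b ∷ reverse m ++ [ a ]
rev-closedPath a m b = trans (unfold-reverse a (m ++ [ b ])) (cong (_++ [ a ]) (reverse-++ m [ b ]))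

Unique-resp-↭ : {A : Set} {xs ys : List A} → xs ↭ ys → Unique xs → Unique ys
Unique-resp-↭ {A = A} p = PermSetoid.Unique-resp-↭ (setoid A) (↭⇒↭ₛ p)

Unique-sameElements⇒↭ : Unique xs → Unique ys → (∀ x → x ∈ xs ⇔ x ∈ ys) → xs ↭ ys
Unique-sameElements⇒↭ u u′ e = ∼bag⇒↭ (unique∧set⇒bag u u′ (λ {x} → e x))

Count-unique : {P : A → Set} {c d : ℕ} → Count P c → Count P d → c ≡ d
Count-unique (xs , u , xs⇔ , refl) (ys , u′ , ys⇔ , refl) =
  ↭-length (Unique-sameElements⇒↭ u u′ (λ x → ⇔.trans (xs⇔ x) (⇔.sym (ys⇔ x))))

Unique-++⁻ˡ : (xs : List A) → Unique (xs ++ ys) → Unique xs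
Unique-++⁻ˡ []       u       = []
Unique-++⁻ˡ (x ∷ xs) (h ∷ u) = All.++⁻ˡ xs h ∷ Unique-++⁻ˡ xs u

Unique-++⁻ʳ : (xs : List A) → Unique (xs ++ ys) → Unique ys
Unique-++⁻ʳ []       u       = u
Unique-++⁻ʳ (x ∷ xs) (h ∷ u) = Unique-++⁻ʳ xs u

Unique-++⇒∉ : (xs : List A) → Unique (xs ++ ys) → w ∈ ys → w ∉ xs
Unique-++⇒∉ (_ ∷ xs) (h ∷ u) w∈ys (here refl) = All.lookup h (∈-++⁺ʳ xs w∈ys) refl
Unique-++⇒∉ (_ ∷ xs) (h ∷ u) w∈ys (there w∈)  = Unique-++⇒∉ xs u w∈ys w∈

Unique-∷ʳ⁺ : Unique xs → w ∉ xs → Unique (xs ++ [ w ])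
Unique-∷ʳ⁺ u x∉ = Unique.++⁺ u ([] ∷ []) λ { (p , here refl) → x∉ p }

Unique-∷ʳ⇒∉ : (xs : List A) → Unique (xs ++ [ w ]) → w ∉ xs
Unique-∷ʳ⇒∉ (_ ∷ xs) (h ∷ u) (here refl) = All.lookup h (∈-++⁺ʳ xs (here refl)) refl
Unique-∷ʳ⇒∉ (_ ∷ xs) (h ∷ u) (there p)   = Unique-∷ʳ⇒∉ xs u p

Unique-map-on : (g : A → B) → (∀ {a b} → a ∈ xs → b ∈ xs → g a ≡ g b → a ≡ b) →
                Unique xs → Unique (map g xs)
Unique-map-on {xs = []}     g inj u       = []
Unique-map-on {xs = x ∷ xs} g inj (h ∷ u) =
  All.tabulate fresh ∷ Unique-map-on g (λ a b → inj (there a) (there b)) u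
  where
  fresh : ∀ {z} → z ∈ map g xs → g x ≢ z
  fresh z∈ eq with ∈-map⁻ g z∈
  ... | y , y∈ , refl = All.lookup h y∈ (inj (here refl) (there y∈) eq)

∈⇒↭∷ : w ∈ xs → ∃[ ys ] (xs ↭ w ∷ ys)
∈⇒↭∷ {w = w} w∈ with ∈-∃++ w∈
... | ys , zs , refl = ys ++ zs , shift w ys zs

CycEdge-sym : CycEdge xs u v → CycEdge xs v u
CycEdge-sym = Sum.swap

CycEdge-∈ : CycEdge xs u v → u ∈ xs × v ∈ xs
CycEdge-∈ {xs = x ∷ xs} (inj₁ p) = Product.map (∈-cycle x xs) (∈-cycle x xs) (pairs-∈ p)
  where
  ∈-cycle : ∀ {z} x xs → z ∈ x ∷ xs ++ [ x ] → z ∈ x ∷ xs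
  ∈-cycle x xs (here e) = here e
  ∈-cycle x xs (there q) with ∈-++⁻ xs q
  ... | inj₁ r        = there r
  ... | inj₂ (here e) = here e
CycEdge-∈ {xs = x ∷ xs} (inj₂ p) = Product.swap (CycEdge-∈ (inj₁ p))

CycEdge-exists : (xs : List A) → 2 ≤ length xs → ∃₂ λ u v → CycEdge xs u v
CycEdge-exists (x ∷ [])    (s≤s ())
CycEdge-exists (x ∷ y ∷ _) _ = x , y , inj₁ (here refl)

CycEdge-resp : {L L′ : List A} → cycPairs L ↭ cycPairs L′ → CycEdge L u v → CycEdge L′ u v
CycEdge-resp p = Sum.map (∈-resp-↭ p) (∈-resp-↭ p)

length-cycPairs : (xs : List A) → length (cycPairs xs) ≡ length xs
length-cycPairs []       = refl
length-cycPairs (x ∷ xs) = trans (length-pairs x (xs ++ [ x ])) (length-∷ʳ xs x)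

cycPairs-rotate₁ : (x : A) (xs : List A) → cycPairs (x ∷ xs) ↭ cycPairs (xs ++ [ x ])
cycPairs-rotate₁ x []      = ↭-refl
cycPairs-rotate₁ x (y ∷ t) = begin
  (x , y) ∷ pairs (y ∷ t ++ [ x ])       ↭⟨ ++-comm [ (x , y) ] _ ⟩
  pairs (y ∷ t ++ [ x ]) ++ [ (x , y) ]  ≡⟨ pairs-++ (y ∷ t) x [ y ] ⟩
  pairs (y ∷ t ++ x ∷ [ y ])             ≡⟨ cong (λ z → pairs (y ∷ z)) (++-assoc t [ x ] [ y ]) ⟨
  pairs (y ∷ (t ++ [ x ]) ++ [ y ])      ∎
  where open PermutationReasoning

cycPairs-rotate : (xs ys : List A) → cycPairs (xs ++ ys) ↭ cycPairs (ys ++ xs)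
cycPairs-rotate []       ys = ↭-reflexive (cong cycPairs (sym (++-identityʳ ys)))
cycPairs-rotate (x ∷ xs) ys = begin
  cycPairs (x ∷ xs ++ ys)         ↭⟨ cycPairs-rotate₁ x (xs ++ ys) ⟩
  cycPairs ((xs ++ ys) ++ [ x ])  ≡⟨ cong cycPairs (++-assoc xs ys [ x ]) ⟩
  cycPairs (xs ++ ys ++ [ x ])    ↭⟨ cycPairs-rotate xs (ys ++ [ x ]) ⟩
  cycPairs ((ys ++ [ x ]) ++ xs)  ≡⟨ cong cycPairs (++-assoc ys [ x ] xs) ⟩
  cycPairs (ys ++ x ∷ xs)         ∎
  where open PermutationReasoning

cycPairs-closedPath : (b : A) (m : List A) (a : A) →
                      cycPairs (b ∷ m ++ [ a ]) ≡ pairs (b ∷ m ++ [ a ]) ++ [ (a , b) ]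
cycPairs-closedPath b m a =
  trans (cong (λ z → pairs (b ∷ z)) (++-assoc m [ a ] [ b ])) (sym (pairs-++ (b ∷ m) a [ b ]))

CycEdge-closedPath : (b : A) (m : List A) (a : A) →
  CycEdge (b ∷ m ++ [ a ]) u v ⇔ (PathEdge (b ∷ m ++ [ a ]) u v ⊎ SameEdge u v a b)
CycEdge-closedPath b m a = mk⇔ to from
  where
  P = b ∷ m ++ [ a ]
  split : ∀ {u v} → (u , v) ∈ cycPairs P → (u , v) ∈ pairs P ⊎ ((u ≡ a) × (v ≡ b))
  split p with ∈-++⁻ (pairs P) (subst (_ ∈_) (cycPairs-closedPath b m a) p)
  ... | inj₁ q            = inj₁ q
  ... | inj₂ (here refl)  = inj₂ (refl , refl)
  join : ∀ {u v} → (u , v) ∈ pairs P → (u , v) ∈ cycPairs P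
  join q = subst (_ ∈_) (sym (cycPairs-closedPath b m a)) (∈-++⁺ˡ q)
  closing : (a , b) ∈ cycPairs P
  closing = subst (_ ∈_) (sym (cycPairs-closedPath b m a)) (∈-++⁺ʳ (pairs P) (here refl))
  to : ∀ {u v} → CycEdge P u v → PathEdge P u v ⊎ SameEdge u v a b
  to (inj₁ p) = Sum.map inj₁ inj₁ (split p)
  to (inj₂ p) = Sum.map inj₂ (inj₂ ∘ Product.swap) (split p)
  from : ∀ {u v} → PathEdge P u v ⊎ SameEdge u v a b → CycEdge P u v
  from (inj₁ (inj₁ q))            = inj₁ (join q)
  from (inj₁ (inj₂ q))            = inj₂ (join q)
  from (inj₂ (inj₁ (refl , refl))) = inj₁ closing
  from (inj₂ (inj₂ (refl , refl))) = inj₂ closing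

CycEdge-distinct : Unique xs → 2 ≤ length xs → CycEdge xs u v → u ≢ v
CycEdge-distinct {xs = xs} u len e with closedPath-form xs len
... | x , m , y , refl with Equivalence.to (CycEdge-closedPath x m y) e
...   | inj₁ pe                  = PathEdge-distinct u pe
...   | inj₂ (inj₁ (refl , refl)) = Unique-∷ʳ⇒∉ (x ∷ m) u ∘ here
...   | inj₂ (inj₂ (refl , refl)) = Unique-∷ʳ⇒∉ (x ∷ m) u ∘ here ∘ sym

record CutAt (L : List A) (a b : A) (m : List A) : Set where
  field
    vertices : L ↭ b ∷ m ++ [ a ]
    edges    : ∀ {u v} → CycEdge L u v ⇔ (PathEdge (b ∷ m ++ [ a ]) u v ⊎ SameEdge u v a b)

private
  Opened : List A → A → A → Set
  Opened L a b = ∃[ m ] (L ↭ b ∷ m ++ [ a ]) × (cycPairs L ↭ cycPairs (b ∷ m ++ [ a ]))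

  opened-rotate : (P : List A) (a b : A) (Q : List A) → Opened (P ++ a ∷ b ∷ Q) a b
  opened-rotate P a b Q = Q ++ P , subst₂ _↭_ split shape (++-comm (P ++ [ a ]) (b ∷ Q))
                                 , subst₂ (λ x y → cycPairs x ↭ cycPairs y) split shape
                                          (cycPairs-rotate (P ++ [ a ]) (b ∷ Q))
    where
    split : (P ++ [ a ]) ++ b ∷ Q ≡ P ++ a ∷ b ∷ Q
    split = ++-assoc P [ a ] (b ∷ Q)
    shape : (b ∷ Q) ++ P ++ [ a ] ≡ b ∷ (Q ++ P) ++ [ a ]
    shape = cong (b ∷_) (sym (++-assoc Q P [ a ]))

  opened : (L : List A) {a b : A} → (a , b) ∈ cycPairs L → a ≢ b → Opened L a b
  opened (x ∷ xs) {a} {b} p a≢b with pairs-∈⇒split p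
  ... | P , Q , eq = go P (initLast Q) eq
    where
    go : ∀ P {Q} → InitLast Q → (x ∷ xs) ++ [ x ] ≡ P ++ a ∷ b ∷ Q → Opened (x ∷ xs) a b
    go P InitLast.[] eq with ∷ʳ-injective (x ∷ xs) (P ++ [ a ]) (trans eq (sym (++-assoc P [ a ] [ b ])))
    go []      InitLast.[] eq | refl , refl = ⊥-elim (a≢b refl)
    go (_ ∷ P) InitLast.[] eq | refl , refl = P , ↭-refl , ↭-refl
    go P (Q ∷ʳ′ q) eq
      with ∷ʳ-injective (x ∷ xs) (P ++ a ∷ b ∷ Q) (trans eq (sym (++-assoc P (a ∷ b ∷ Q) [ q ])))
    ... | e , refl = subst (λ L → Opened L a b) (sym e) (opened-rotate P a b Q)

  opened⇒cutAt : (L : List A) → ((m , _) : Opened L a b) → CutAt L a b m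
  opened⇒cutAt {a = a} {b} L (m , perm , cp) = record
    { vertices = perm
    ; edges    = λ {u v} → mk⇔ (Equivalence.to (closed u v) ∘ CycEdge-resp {L = L} cp)
                                 (CycEdge-resp {L′ = L} (↭-sym cp) ∘ Equivalence.from (closed u v))
    }
    where
    closed : ∀ u v → CycEdge (b ∷ m ++ [ a ]) u v ⇔ (PathEdge (b ∷ m ++ [ a ]) u v ⊎ SameEdge u v a b)
    closed u v = CycEdge-closedPath b m a

cutAt : (L : List A) → CycEdge L a b → a ≢ b → ∃[ m ] CutAt L a b m
cutAt L (inj₁ p) a≢b = let o = opened L p a≢b in proj₁ o , opened⇒cutAt L o
cutAt {a = a} {b} L (inj₂ p) a≢b = reverse m , record
  { vertices = subst (L ↭_) (rev-closedPath a m b) (↭-trans vertices (↭-sym (↭-reverse _)))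
  ; edges    = mk⇔ (Sum.map reverse-path SameEdge-swap ∘ Equivalence.to edges)
                   (Equivalence.from edges ∘ Sum.map unreverse-path SameEdge-swap)
  }
  where
  o = opened L p (a≢b ∘ sym)
  m = proj₁ o
  open CutAt (opened⇒cutAt L o)
  reverse-path : ∀ {u v} → PathEdge (a ∷ m ++ [ b ]) u v → PathEdge (b ∷ reverse m ++ [ a ]) u v
  reverse-path e = subst (λ z → PathEdge z _ _) (rev-closedPath a m b) (PathEdge-reverse _ e)
  unreverse-path : ∀ {u v} → PathEdge (b ∷ reverse m ++ [ a ]) u v → PathEdge (a ∷ m ++ [ b ]) u v
  unreverse-path e = PathEdge-reverse⁻ _ (subst (λ z → PathEdge z _ _) (sym (rev-closedPath a m b)) e)

Chain-map : {R′ : A → A → Set} → (∀ {a b} → R a b → R′ a b) → Chain R xs → Chain R′ xs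
Chain-map f nil        = nil
Chain-map f one        = one
Chain-map f (cons r c) = cons (f r) (Chain-map f c)

Chain-pairs : Chain R xs → (u , v) ∈ pairs xs → R u v
Chain-pairs (cons r c) (here refl) = r
Chain-pairs (cons r c) (there p)   = Chain-pairs c p

Chain-++ : (xs : List A) → Chain R (xs ++ [ w ]) → Chain R (w ∷ ys) → Chain R (xs ++ w ∷ ys)
Chain-++ []          c₁          c₂ = c₂
Chain-++ (_ ∷ [])    (cons r _)  c₂ = cons r c₂
Chain-++ (_ ∷ y ∷ t) (cons r c₁) c₂ = cons r (Chain-++ (y ∷ t) c₁ c₂)

Chain-∷ʳ : Chain R xs → last xs ≡ just w → R w z → Chain R (xs ++ [ z ])
Chain-∷ʳ {xs = _ ∷ []}    one         refl r = cons r one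
Chain-∷ʳ {xs = _ ∷ _ ∷ _} (cons r′ c) e    r = cons r′ (Chain-∷ʳ c e r)

Chain-All : {P : A → Set} → (∀ {a b} → R a b → P b) → Chain R (w ∷ xs) → P w → All P (w ∷ xs)
Chain-All f one        px = px ∷ []
Chain-All f (cons r c) px = px ∷ Chain-All f c (f r)

last-∷ʳ : (xs : List A) (x : A) → last (xs ++ [ x ]) ≡ just x
last-∷ʳ []          x = refl
last-∷ʳ (_ ∷ [])    x = refl
last-∷ʳ (_ ∷ y ∷ t) x = last-∷ʳ (y ∷ t) x

last-++ : (xs : List A) (y : A) (ys : List A) → last (xs ++ y ∷ ys) ≡ last (y ∷ ys)
last-++ []          y ys = refl
last-++ (_ ∷ [])    y ys = refl
last-++ (_ ∷ x ∷ t) y ys = last-++ (x ∷ t) y ys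

Chain-closed⇒IsCycle : {R : A → A → Set} {x y : A} {xs : List A} → (∀ {a b} → R a b → R b a) →
  3 ≤ length (x ∷ xs) → Unique (x ∷ xs) → Chain R (x ∷ xs) → last (x ∷ xs) ≡ just y → R y x →
  IsCycle R (x ∷ xs)
Chain-closed⇒IsCycle {R = R} {x} {xs = xs} symR len u c e r = len , u , edge
  where
  edge : ∀ a b → CycEdge (x ∷ xs) a b → R a b
  edge a b (inj₁ p) = Chain-pairs (Chain-∷ʳ c e r) p
  edge a b (inj₂ p) = symR (Chain-pairs (Chain-∷ʳ c e r) p)

Chain-exit : {P : A → Set} → (∀ x → Dec (P x)) → Chain R xs → Ends xs a b → P a → ¬ P b →
             ∃₂ λ p q → R p q × P p × ¬ P q
Chain-exit {xs = _ ∷ []}    P? one        (refl , refl) pa ¬pb = ⊥-elim (¬pb pa)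
Chain-exit {xs = x ∷ y ∷ t} P? (cons r c) (refl , e)    pa ¬pb with P? y
... | yes py = Chain-exit P? c (refl , e) py ¬pb
... | no ¬py = x , y , r , pa , ¬py

record FirstEntry (P : A → Set) (R : A → A → Set) (x : A) (xs : List A) : Set where
  field
    outside : List A
    entry   : A
    chain   : Chain R (x ∷ outside ++ [ entry ])
    unique  : Unique (x ∷ outside ++ [ entry ])
    ¬P-outside : All (¬_ ∘ P) outside
    P-entry : P entry
    ⊆-path  : ∀ {z} → z ∈ x ∷ outside ++ [ entry ] → z ∈ x ∷ xs

Chain-firstEntry : {P : A → Set} → (∀ x → Dec (P x)) → (x : A) (xs : List A) → ¬ P x → P z →
                   last (x ∷ xs) ≡ just z → Chain R (x ∷ xs) → Unique (x ∷ xs) → FirstEntry P R x xs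
Chain-firstEntry P? x []       ¬px py refl c u = ⊥-elim (¬px py)
Chain-firstEntry P? x (y ∷ ys) ¬px pz e (cons r c) u with P? y
... | yes py = record
  { outside = [] ; entry = y ; chain = cons r one
  ; unique = ((λ eq → Unique[x∷xs]⇒x∉xs u (here eq)) ∷ []) ∷ [] ∷ []
  ; ¬P-outside = [] ; P-entry = py
  ; ⊆-path = λ { (here refl) → here refl ; (there (here refl)) → there (here refl) } }
... | no ¬py = record
  { outside = y ∷ outside ; entry = entry ; chain = cons r chain
  ; unique = All.tabulate (λ z∈ x≡z → Unique[x∷xs]⇒x∉xs u (subst (_∈ y ∷ ys) (sym x≡z) (⊆-path z∈)))
             ∷ unique
  ; ¬P-outside = ¬py ∷ ¬P-outside ; P-entry = P-entry
  ; ⊆-path = λ { (here refl) → here refl ; (there q) → there (⊆-path q) } }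
  where open FirstEntry (Chain-firstEntry P? y ys ¬py pz e c (AllPairs.tail u))

-- Unordered pairs of vertices as sorted pairs

module _ {n : ℕ} where

  sortPair : Fin n × Fin n → Fin n × Fin n
  sortPair (u , v) with toℕ u ℕ.<? toℕ v
  ... | yes _ = u , v
  ... | no  _ = v , u

  sortPair-cases : (u v : Fin n) → (sortPair (u , v) ≡ (u , v)) ⊎ (sortPair (u , v) ≡ (v , u))
  sortPair-cases u v with toℕ u ℕ.<? toℕ v
  ... | yes _ = inj₁ refl
  ... | no  _ = inj₂ refl

  sortPair-< : (u v : Fin n) → u ≢ v → toℕ (proj₁ (sortPair (u , v))) < toℕ (proj₂ (sortPair (u , v)))
  sortPair-< u v u≢v with toℕ u ℕ.<? toℕ v
  ... | yes u<v = u<v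
  ... | no  u≮v = ≤∧≢⇒< (≤-pred (≰⇒> u≮v)) (u≢v ∘ toℕ-injective ∘ sym)

  sortPair-sorted : (u v : Fin n) → toℕ u < toℕ v → sortPair (u , v) ≡ (u , v)
  sortPair-sorted u v u<v with toℕ u ℕ.<? toℕ v
  ... | yes _   = refl
  ... | no  u≮v = ⊥-elim (u≮v u<v)

  sortPair-unsorted : (u v : Fin n) → toℕ u < toℕ v → sortPair (v , u) ≡ (u , v)
  sortPair-unsorted u v u<v with toℕ v ℕ.<? toℕ u
  ... | yes v<u = ⊥-elim (<-asym u<v v<u)
  ... | no  _   = refl

  sortPair-swap : (u v : Fin n) → sortPair (u , v) ≡ sortPair (v , u)
  sortPair-swap u v with toℕ u ℕ.<? toℕ v | toℕ v ℕ.<? toℕ u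
  ... | yes u<v | yes v<u = ⊥-elim (<-asym u<v v<u)
  ... | yes _   | no  _   = refl
  ... | no  _   | yes _   = refl
  ... | no  u≮v | no  v≮u with toℕ-injective (≤-antisym (≤-pred (≰⇒> v≮u)) (≤-pred (≰⇒> u≮v)))
  ...   | refl = refl

  sortPair-≡⇒SameEdge : (u v p q : Fin n) → sortPair (u , v) ≡ sortPair (p , q) → SameEdge u v p q
  sortPair-≡⇒SameEdge u v p q eq with sortPair-cases u v | sortPair-cases p q
  ... | inj₁ e₁ | inj₁ e₂ = inj₁ (,-injective (trans (sym e₁) (trans eq e₂)))
  ... | inj₁ e₁ | inj₂ e₂ = inj₂ (,-injective (trans (sym e₁) (trans eq e₂)))
  ... | inj₂ e₁ | inj₁ e₂ = inj₂ (Product.swap (,-injective (trans (sym e₁) (trans eq e₂))))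
  ... | inj₂ e₁ | inj₂ e₂ = inj₁ (Product.swap (,-injective (trans (sym e₁) (trans eq e₂))))

  Unique-sortPair-pairs : {xs : List (Fin n)} → Unique xs → Unique (map sortPair (pairs xs))
  Unique-sortPair-pairs {[]}        u = []
  Unique-sortPair-pairs {_ ∷ []}    u = []
  Unique-sortPair-pairs {x ∷ y ∷ t} u = All.tabulate new ∷ Unique-sortPair-pairs (AllPairs.tail u)
    where
    new : ∀ {e} → e ∈ map sortPair (pairs (y ∷ t)) → sortPair (x , y) ≢ e
    new e∈ eq with ∈-map⁻ sortPair e∈
    ... | (p , q) , pq∈ , refl with sortPair-≡⇒SameEdge x y p q eq
    ... | inj₁ (refl , _) = Unique[x∷xs]⇒x∉xs u (proj₁ (pairs-∈ pq∈))
    ... | inj₂ (refl , _) = Unique[x∷xs]⇒x∉xs u (proj₂ (pairs-∈ pq∈))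

  Unique-sortPair-cycPairs : (xs : List (Fin n)) → Unique xs → 3 ≤ length xs →
                             Unique (map sortPair (cycPairs xs))
  Unique-sortPair-cycPairs xs u len with closedPath-form xs (≤-trans (s≤s (s≤s z≤n)) len)
  ... | x , m , y , refl
    rewrite cycPairs-closedPath x m y | map-++ sortPair (pairs (x ∷ m ++ [ y ])) [ (y , x) ] =
    Unique.++⁺ (Unique-sortPair-pairs u) ([] ∷ []) notClosing
    where
    notClosing : ∀ {e} → ¬ (e ∈ map sortPair (pairs (x ∷ m ++ [ y ])) × e ∈ [ sortPair (y , x) ])
    notClosing (e∈ , here refl) with ∈-map⁻ sortPair e∈
    ... | (p , q) , pq∈ , eq with sortPair-≡⇒SameEdge p q y x (sym eq)
    ... | same with PathEdge-joining-ends x m y u (inj₁ pq∈) (Sum.swap (Sum.map proj₁ proj₁ same))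
                                                             (Sum.map proj₂ proj₂ same)
    ...   | refl = <-irrefl refl len

  sortPair-∈⇒CycEdge : {xs : List (Fin n)} {e : Fin n × Fin n} → e ∈ map sortPair (cycPairs xs) →
                       CycEdge xs (proj₁ e) (proj₂ e)
  sortPair-∈⇒CycEdge e∈ with ∈-map⁻ sortPair e∈
  ... | (p , q) , pq∈ , refl with sortPair-cases p q
  ... | inj₁ eq rewrite eq = inj₁ pq∈
  ... | inj₂ eq rewrite eq = inj₂ pq∈

  CycEdge⇒sortPair-∈ : {xs : List (Fin n)} {u v : Fin n} → CycEdge xs u v →
                       sortPair (u , v) ∈ map sortPair (cycPairs xs)
  CycEdge⇒sortPair-∈         (inj₁ p) = ∈-map⁺ sortPair p
  CycEdge⇒sortPair-∈ {u = u} {v} (inj₂ p) = subst (_∈ _) (sortPair-swap v u) (∈-map⁺ sortPair p)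

  module _ (Q : Fin n → Fin n → Set) (symQ : ∀ {a b} → Q a b → Q b a) (u v : Fin n) where

    sortPair-preserves : Q u v → uncurry Q (sortPair (u , v))
    sortPair-preserves q with sortPair-cases u v
    ... | inj₁ eq rewrite eq = q
    ... | inj₂ eq rewrite eq = symQ q

    sortPair-reflects : uncurry Q (sortPair (u , v)) → Q u v
    sortPair-reflects q with sortPair-cases u v
    ... | inj₁ eq rewrite eq = q
    ... | inj₂ eq rewrite eq = symQ q

euler-step : ∀ c m s e → c + s ≡ e + 1 → (c + m) + suc s ≡ (suc m + e) + 1
euler-step c m s e h = begin
  (c + m) + suc s    ≡⟨ shuffle c m s ⟩
  (c + s) + suc m    ≡⟨ cong (_+ suc m) h ⟩
  (e + 1) + suc m    ≡⟨ collect e m ⟩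
  (suc m + e) + 1    ∎
  where
  open ≡-Reasoning
  shuffle : ∀ c m s → (c + m) + suc s ≡ (c + s) + suc m
  shuffle = solve-∀
  collect : ∀ e m → (e + 1) + suc m ≡ (suc m + e) + 1
  collect = solve-∀

boundary-length-step : ∀ c m s σ → c + 2 * s ≡ σ + 2 → (c + m) + 2 * suc s ≡ ((m + 2) + σ) + 2
boundary-length-step c m s σ h = begin
  (c + m) + 2 * suc s     ≡⟨ shuffle c m s ⟩
  (c + 2 * s) + (m + 2)   ≡⟨ cong (_+ (m + 2)) h ⟩
  (σ + 2) + (m + 2)       ≡⟨ collect σ m ⟩
  ((m + 2) + σ) + 2       ∎
  where
  open ≡-Reasoning
  shuffle : ∀ c m s → (c + m) + 2 * suc s ≡ (c + 2 * s) + (m + 2)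
  shuffle = solve-∀
  collect : ∀ σ m → (σ + 2) + (m + 2) ≡ ((m + 2) + σ) + 2
  collect = solve-∀

cancel-doubled : ∀ c n k → c + 2 * suc k ≡ (n + 2 * k) + 2 → c ≡ n
cancel-doubled c n k h = +-cancelʳ-≡ (2 * k + 2) c n (trans (shuffle c k) (trans h (shuffle′ n k)))
  where
  shuffle : ∀ c k → c + (2 * k + 2) ≡ c + 2 * suc k
  shuffle = solve-∀
  shuffle′ : ∀ n k → (n + 2 * k) + 2 ≡ n + (2 * k + 2)
  shuffle′ = solve-∀

module PolyhedralMap {n f : ℕ} {face : Fin f → List (Fin n)} (PM : Map.IsPolyhedralMap face) where

  open Map face
  open IsPolyhedralMap PM

  facet-unique : ∀ i → Unique (face i)
  facet-unique i = proj₂ (facetPolygon i)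

  facet-length : ∀ i → 3 ≤ length (face i)
  facet-length i = proj₁ (facetPolygon i)

  FEdge-∈ : ∀ {i u v} → FEdge i u v → u ∈ face i × v ∈ face i
  FEdge-∈ {i} = CycEdge-∈ {xs = face i}

  FEdge-sym : ∀ {i u v} → FEdge i u v → FEdge i v u
  FEdge-sym {i} = CycEdge-sym {xs = face i}

  FEdge-distinct : ∀ {i u v} → FEdge i u v → u ≢ v
  FEdge-distinct {i} = CycEdge-distinct (facet-unique i) (≤-trans (s≤s (s≤s z≤n)) (facet-length i))

  FEdge? : ∀ i u v → Dec (FEdge i u v)
  FEdge? i u v = ((u , v) ∈? cycPairs (face i)) ⊎-dec ((v , u) ∈? cycPairs (face i))
    where open DecMembership (≡-dec Fin._≟_ Fin._≟_)

  sharedEdge-unique : ∀ {i j p q r s} → i ≢ j →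
                      FEdge i p q → FEdge j p q → FEdge i r s → FEdge j r s →
                      toℕ p < toℕ q → toℕ r < toℕ s → (p , q) ≡ (r , s)
  sharedEdge-unique {i} {j} {p} {q} {r} {s} i≢j piq pjq ris rjs p<q r<s = decide (p Fin.≟ r) (q Fin.≟ s)
    where
    Corner : Fin n → Set
    Corner w = (w ≡ p) ⊎ (w ≡ q) ⊎ (w ≡ r) ⊎ (w ≡ s)
    common : ∀ {w} → Corner w → w ∈ face i × w ∈ face j
    common (inj₁ refl)               = proj₁ (FEdge-∈ piq) , proj₁ (FEdge-∈ pjq)
    common (inj₂ (inj₁ refl))        = proj₂ (FEdge-∈ piq) , proj₂ (FEdge-∈ pjq)
    common (inj₂ (inj₂ (inj₁ refl))) = proj₁ (FEdge-∈ ris) , proj₁ (FEdge-∈ rjs)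
    common (inj₂ (inj₂ (inj₂ refl))) = proj₂ (FEdge-∈ ris) , proj₂ (FEdge-∈ rjs)
    three : ∀ {a b c} → Corner a → Corner b → Corner c → a ≢ b → b ≢ c → a ≢ c → ⊥
    three ca cb cc = meetNoThree i j i≢j _ _ _ (proj₁ (common ca)) (proj₂ (common ca))
                       (proj₁ (common cb)) (proj₂ (common cb)) (proj₁ (common cc)) (proj₂ (common cc))
    cp = inj₁ refl
    cq = inj₂ (inj₁ refl)
    cr = inj₂ (inj₂ (inj₁ refl))
    cs = inj₂ (inj₂ (inj₂ refl))
    p≢q : p ≢ q
    p≢q = <⇒≢ p<q ∘ cong toℕ
    r≢s : r ≢ s
    r≢s = <⇒≢ r<s ∘ cong toℕ
    decide : Dec (p ≡ r) → Dec (q ≡ s) → (p , q) ≡ (r , s)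
    decide (yes p≡r) (yes q≡s) = cong₂ _,_ p≡r q≡s
    decide (yes p≡r) (no q≢s)  = ⊥-elim (three cp cq cs p≢q q≢s (r≢s ∘ trans (sym p≡r)))
    decide (no p≢r)  (yes q≡s) = ⊥-elim (three cp cr cq p≢r (r≢s ∘ flip trans q≡s) p≢q)
    decide (no p≢r)  (no q≢s) with r Fin.≟ q
    ... | yes r≡q = ⊥-elim (three cp cq cs p≢q q≢s (<⇒≢ p<s ∘ cong toℕ))
      where p<s = <-trans p<q (subst (λ z → toℕ z < toℕ s) r≡q r<s)
    ... | no r≢q  = ⊥-elim (three cp cq cr p≢q (r≢q ∘ sym) p≢r)

  facetEdges : Fin f → List (Fin n × Fin n)
  facetEdges i = map sortPair (cycPairs (face i))

  facetEdges-unique : ∀ i → Unique (facetEdges i)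
  facetEdges-unique i = Unique-sortPair-cycPairs (face i) (facet-unique i) (facet-length i)

  facetEdges-length : ∀ i → length (facetEdges i) ≡ length (face i)
  facetEdges-length i = trans (length-map sortPair (cycPairs (face i))) (length-cycPairs (face i))

  facetEdges-FEdge : ∀ {i e} → e ∈ facetEdges i → uncurry (FEdge i) e
  facetEdges-FEdge {i} = sortPair-∈⇒CycEdge {xs = face i}

  facetEdges-< : ∀ {i e} → e ∈ facetEdges i → toℕ (proj₁ e) < toℕ (proj₂ e)
  facetEdges-< {i} e∈ with ∈-map⁻ sortPair e∈
  ... | (p , q) , pq∈ , refl = sortPair-< p q (FEdge-distinct {i} (inj₁ pq∈))

  FEdge⇒facetEdges : ∀ {i u v} → toℕ u < toℕ v → FEdge i u v → (u , v) ∈ facetEdges i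
  FEdge⇒facetEdges {i} {u} {v} u<v e =
    subst (_∈ facetEdges i) (sortPair-sorted u v u<v) (CycEdge⇒sortPair-∈ {xs = face i} e)

  private
    -- The facet on the other side of the edge uv of facet i, or the junk value i if uv is not an edge of i.
    across : Fin f → Fin n × Fin n → Fin f
    across i (u , v) with FEdge? i u v
    ... | yes e = proj₁ (edgeTwo i u v e)
    ... | no  _ = i

    across-spec : ∀ {i u v} → FEdge i u v → (across i (u , v) ≢ i) × FEdge (across i (u , v)) u v
    across-spec {i} {u} {v} e with FEdge? i u v
    ... | yes e′ = proj₂ (edgeTwo i u v e′)
    ... | no ¬e  = ⊥-elim (¬e e)

    neighbours : Fin f → List (Fin f)
    neighbours i = map (across i) (facetEdges i)

    neighbours-unique : ∀ i → Unique (neighbours i)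
    neighbours-unique i = Unique-map-on (across i) injective (facetEdges-unique i)
      where
      injective : ∀ {d e} → d ∈ facetEdges i → e ∈ facetEdges i → across i d ≡ across i e → d ≡ e
      injective d∈ e∈ eq =
        let sd = across-spec (facetEdges-FEdge d∈) ; se = across-spec (facetEdges-FEdge e∈)
        in sharedEdge-unique (proj₁ sd ∘ sym) (facetEdges-FEdge d∈) (proj₂ sd) (facetEdges-FEdge e∈)
                             (subst (λ j → uncurry (FEdge j) _) (sym eq) (proj₂ se))
                             (facetEdges-< d∈) (facetEdges-< e∈)

    neighbours-∈⇔ : ∀ i j → j ∈ neighbours i ⇔ AdjM i j
    neighbours-∈⇔ i j = mk⇔ to from
      where
      to : j ∈ neighbours i → AdjM i j
      to j∈ with ∈-map⁻ (across i) j∈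
      ... | (u , v) , e∈ , refl = let s = across-spec (facetEdges-FEdge e∈) in
                                  proj₁ s ∘ sym , u , v , facetEdges-FEdge e∈ , proj₂ s
      from : AdjM i j → j ∈ neighbours i
      from (i≢j , u , v , eᵢ , eⱼ) = subst (_∈ neighbours i) (sym j≡k) (∈-map⁺ (across i) e∈)
        where
        e∈ = CycEdge⇒sortPair-∈ {xs = face i} eᵢ
        k = across i (sortPair (u , v))
        s = across-spec (facetEdges-FEdge e∈)
        eₖ : FEdge k u v
        eₖ = sortPair-reflects (FEdge k) FEdge-sym u v (proj₂ s)
        j≡k : j ≡ k
        j≡k with edgeAtMostTwo i j k u v eᵢ eⱼ eₖ
        ... | inj₁ i≡j        = ⊥-elim (i≢j i≡j)
        ... | inj₂ (inj₁ j≡k) = j≡k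
        ... | inj₂ (inj₂ i≡k) = ⊥-elim (proj₁ s (sym i≡k))

  AdjM-count : ∀ i → Count (AdjM i) (length (face i))
  AdjM-count i = neighbours i , neighbours-unique i , neighbours-∈⇔ i
               , trans (length-map (across i) (facetEdges i)) (facetEdges-length i)

module ProperTree {n f : ℕ} {face : Fin f → List (Fin n)} (PM : Map.IsPolyhedralMap face)
                  {deg : Fin f → ℕ} {vs : List (Fin f)} {es : List (Fin f × Fin f)}
                  (PT : Map.IsProperTree face deg vs es) where

  open Map face
  open IsPolyhedralMap PM using (meetNoThree; edgeAtMostTwo)
  open IsProperTree PT using (tree; cond1; cond2)
  open IsTreeInM tree using (edgesOk; acyclic; distinct; nonempty) renaming (connected to tree-connected)
  open PolyhedralMap PM
  open DecMembership (Fin._≟_ {f}) using (_∈?_)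

  TE : Fin f → Fin f → Set
  TE = TEdge es

  TE-sym : ∀ {a b} → TE a b → TE b a
  TE-sym = Sum.swap

  TE-endpoints : ∀ {a b} → TE a b → a ∈ vs × b ∈ vs × AdjM a b
  TE-endpoints (inj₁ p) = edgesOk _ _ p
  TE-endpoints (inj₂ p) with edgesOk _ _ p
  ... | b∈ , a∈ , b≢a , u , v , eb , ea = a∈ , b∈ , b≢a ∘ sym , u , v , ea , eb

  PathWithin : List (Fin f) → Fin f → Fin f → Set
  PathWithin S a b = ∃[ xs ] (Unique xs × Chain TE xs × All (_∈ S) xs × Ends xs a b)

  ConnectedWithin : List (Fin f) → Set
  ConnectedWithin S = ∀ {a b} → a ∈ S → b ∈ S → PathWithin S a b

  private
    reentry-closes-cycle : ∀ {S F G} → ConnectedWithin S → F ∉ S → G ∈ S → TE F G →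
      (R : List (Fin f)) (H : Fin f) → Chain TE (F ∷ R ++ [ H ]) → Unique (F ∷ R ++ [ H ]) →
      All (_∉ S) R → H ∈ S → (R ≡ [] → H ≢ G) → ⊥
    reentry-closes-cycle {S} {F} {G} conn F∉S G∈S tFG R H ch u R∉S H∈S nontrivial with conn H∈S G∈S
    ... | H ∷ ps , ps-unique , ps-chain , ps⊆S , refl , last≡G =
      acyclic cycle (Chain-closed⇒IsCycle TE-sym (length≥3 R ps last≡G nontrivial) unique
                       (Chain-++ (F ∷ R) ch ps-chain) (trans (last-++ (F ∷ R) H ps) last≡G) (TE-sym tFG))
      where
      cycle = F ∷ R ++ H ∷ ps
      unique : Unique cycle
      unique = Unique.++⁺ (Unique-++⁻ˡ (F ∷ R) u) ps-unique λ where
        (here refl , z∈) → F∉S (All.lookup ps⊆S z∈)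
        (there z∈R , z∈) → All.lookup R∉S z∈R (All.lookup ps⊆S z∈)
      length≥3 : ∀ R ps → last (H ∷ ps) ≡ just G → (R ≡ [] → H ≢ G) →
                 3 ≤ length (F ∷ R ++ H ∷ ps)
      length≥3 []      []      refl nt = ⊥-elim (nt refl refl)
      length≥3 []      (_ ∷ _) _    _  = s≤s (s≤s (s≤s z≤n))
      length≥3 (_ ∷ R) ps      _    _  =
        s≤s (s≤s (subst (1 ≤_) (sym (length-++ R)) (≤-trans (s≤s z≤n) (m≤n+m (suc (length ps)) (length R)))))

  reentry-is-attachingEdge : ∀ {S F G} → ConnectedWithin S → F ∉ S → G ∈ S → TE F G →
    (R : List (Fin f)) (H : Fin f) → Chain TE (F ∷ R ++ [ H ]) → Unique (F ∷ R ++ [ H ]) →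
    All (_∉ S) R → H ∈ S → (R ≡ []) × (H ≡ G)
  reentry-is-attachingEdge {G = G} conn F∉S G∈S tFG R H ch u R∉S H∈S with R | H Fin.≟ G
  ... | []    | yes H≡G = refl , H≡G
  ... | []    | no  H≢G = ⊥-elim (reentry-closes-cycle conn F∉S G∈S tFG [] H ch u R∉S H∈S (λ _ → H≢G))
  ... | r ∷ R | _       = ⊥-elim (reentry-closes-cycle conn F∉S G∈S tFG (r ∷ R) H ch u R∉S H∈S (λ ()))

  leaf-meets-subdisk-in-edge : ∀ {S F G x y w} → ConnectedWithin S → (∀ {i} → i ∈ S → i ∈ vs) →
    F ∈ vs → F ∉ S → G ∈ S → TE F G → FEdge F x y → FEdge G x y →
    w ∈ face F → w ≢ x → w ≢ y → ¬ Sub.DVertex S w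
  leaf-meets-subdisk-in-edge {S} {F} {G} {x} {y} {w} conn S⊆vs F∈vs F∉S G∈S tFG eF eG w∈F w≢x w≢y
                             (H , H∈S , w∈H)
    with cond2 w F H F∈vs (S⊆vs H∈S) w∈F w∈H
  ... | F ∷ xs , u , ch , refl , last≡H = meetNoThree F G F≢G w x y w∈F w∈G
                                            (proj₁ (FEdge-∈ eF)) (proj₁ (FEdge-∈ eG))
                                            (proj₂ (FEdge-∈ eF)) (proj₂ (FEdge-∈ eG))
                                            w≢x (FEdge-distinct eF) w≢y
    where
    open FirstEntry (Chain-firstEntry (_∈? S) F xs F∉S H∈S last≡H ch u)
    F≢G : F ≢ G
    F≢G = proj₁ (proj₂ (proj₂ (TE-endpoints tFG)))
    entry≡G : entry ≡ G
    entry≡G = proj₂ (reentry-is-attachingEdge conn F∉S G∈S tFG outside entry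
                       (Chain-map proj₁ chain) unique ¬P-outside P-entry)
    around-w : All (λ i → w ∈ face i) (F ∷ xs)
    around-w = Chain-All (λ { (_ , _ , _ , _ , e) → proj₁ (FEdge-∈ e) }) ch w∈F
    w∈G : w ∈ face G
    w∈G = subst (λ i → w ∈ face i) entry≡G
                (All.lookup around-w (⊆-path (∈-++⁺ʳ (F ∷ outside) (here refl))))

  record SubDisk (S : List (Fin f)) : Set where
    field
      boundary          : List (Fin n)
      edges             : List (Fin n × Fin n)
      connected         : ConnectedWithin S
      boundary-unique   : Unique boundary
      boundary-length≥3 : 3 ≤ length boundary
      boundary⇒DVertex  : ∀ {u} → u ∈ boundary → Sub.DVertex S u
      DVertex⇒boundary  : ∀ {u} → Sub.DVertex S u → u ∈ boundary
      BdEdge⇒boundary   : ∀ {u v} → Sub.BdEdge S u v → CycEdge boundary u v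
      boundary⇒BdEdge   : ∀ {u v} → CycEdge boundary u v → Sub.BdEdge S u v
      edges-unique      : Unique edges
      edges⇒DEdgeOrd    : ∀ {e} → e ∈ edges → Sub.DEdgeOrd S e
      DEdgeOrd⇒edges    : ∀ {e} → Sub.DEdgeOrd S e → e ∈ edges
      euler             : length boundary + length S ≡ length edges + 1
      boundary-length   : length boundary + 2 * length S ≡ sum (map (length ∘ face) S) + 2

  singleFacet : ∀ i → SubDisk [ i ]
  singleFacet i = record
    { boundary          = face i
    ; edges             = facetEdges i
    ; connected         = λ { (here refl) (here refl) → [ i ] , [] ∷ [] , one , here refl ∷ [] , refl , refl }
    ; boundary-unique   = facet-unique i
    ; boundary-length≥3 = facet-length i
    ; boundary⇒DVertex  = λ u∈ → i , here refl , u∈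
    ; DVertex⇒boundary  = λ { (_ , here refl , u∈) → u∈ }
    ; BdEdge⇒boundary   = λ { (_ , here refl , e , _) → e }
    ; boundary⇒BdEdge   = λ e → i , here refl , e , λ { _ (here refl) _ → refl }
    ; edges-unique      = facetEdges-unique i
    ; edges⇒DEdgeOrd    = λ e∈ → facetEdges-< e∈ , i , here refl , facetEdges-FEdge e∈
    ; DEdgeOrd⇒edges    = λ { {_ , _} (u<v , _ , here refl , e) → FEdge⇒facetEdges u<v e }
    ; euler             = cong (_+ 1) (sym (facetEdges-length i))
    ; boundary-length   = cong (_+ 2) (sym (+-identityʳ (length (face i))))
    }

  module Attach {S : List (Fin f)} (D : SubDisk S) (S⊆vs : ∀ {i} → i ∈ S → i ∈ vs)
                {F G : Fin f} (F∈vs : F ∈ vs) (F∉S : F ∉ S) (G∈S : G ∈ S) (tFG : TE F G) where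

    open SubDisk D

    adjacent : AdjM F G
    adjacent = proj₂ (proj₂ (TE-endpoints tFG))

    F≢G : F ≢ G
    F≢G = proj₁ adjacent

    x y : Fin n
    x = proj₁ (proj₂ adjacent)
    y = proj₁ (proj₂ (proj₂ adjacent))

    eF : FEdge F x y
    eF = proj₁ (proj₂ (proj₂ (proj₂ adjacent)))

    eG : FEdge G x y
    eG = proj₂ (proj₂ (proj₂ (proj₂ adjacent)))

    x≢y : x ≢ y
    x≢y = FEdge-distinct eF

    xy-boundary : Sub.BdEdge S x y
    xy-boundary = G , G∈S , eG , only-G
      where
      only-G : ∀ j → j ∈ S → FEdge j x y → j ≡ G
      only-G j j∈S ej with edgeAtMostTwo G j F x y eG ej eF
      ... | inj₁ G≡j        = sym G≡j
      ... | inj₂ (inj₁ refl) = ⊥-elim (F∉S j∈S)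
      ... | inj₂ (inj₂ G≡F) = ⊥-elim (F≢G (sym G≡F))

    mC : List (Fin n)
    mC = proj₁ (cutAt boundary (BdEdge⇒boundary xy-boundary) x≢y)

    cutC : CutAt boundary x y mC
    cutC = proj₂ (cutAt boundary (BdEdge⇒boundary xy-boundary) x≢y)

    mF : List (Fin n)
    mF = proj₁ (cutAt (face F) (FEdge-sym eF) (x≢y ∘ sym))

    cutF : CutAt (face F) y x mF
    cutF = proj₂ (cutAt (face F) (FEdge-sym eF) (x≢y ∘ sym))

    PC PF : List (Fin n)
    PC = y ∷ mC ++ [ x ]
    PF = x ∷ mF ++ [ y ]

    PC-unique : Unique PC
    PC-unique = Unique-resp-↭ (CutAt.vertices cutC) boundary-unique

    PF-unique : Unique PF
    PF-unique = Unique-resp-↭ (CutAt.vertices cutF) (facet-unique F)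

    PC⇒boundary : ∀ {u} → u ∈ PC → u ∈ boundary
    PC⇒boundary = ∈-resp-↭ (↭-sym (CutAt.vertices cutC))

    boundary⇒PC : ∀ {u} → u ∈ boundary → u ∈ PC
    boundary⇒PC = ∈-resp-↭ (CutAt.vertices cutC)

    PF⇒F : ∀ {u} → u ∈ PF → u ∈ face F
    PF⇒F = ∈-resp-↭ (↭-sym (CutAt.vertices cutF))

    F⇒PF : ∀ {u} → u ∈ face F → u ∈ PF
    F⇒PF = ∈-resp-↭ (CutAt.vertices cutF)

    length-PC : length boundary ≡ length mC + 2
    length-PC = trans (↭-length (CutAt.vertices cutC)) (length-closedPath y mC x)

    length-PF : length (face F) ≡ length mF + 2
    length-PF = trans (↭-length (CutAt.vertices cutF)) (length-closedPath x mF y)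

    mF-fresh : ∀ {w} → w ∈ mF → ¬ Sub.DVertex S w
    mF-fresh w∈ = leaf-meets-subdisk-in-edge connected S⊆vs F∈vs F∉S G∈S tFG eF eG
                    (PF⇒F (there (∈-++⁺ˡ w∈)))
                    (λ w≡x → Unique[x∷xs]⇒x∉xs PF-unique (subst (_∈ mF ++ [ y ]) w≡x (∈-++⁺ˡ w∈)))
                    (λ w≡y → Unique-∷ʳ⇒∉ mF (Unique-++⁻ʳ [ x ] PF-unique) (subst (_∈ mF) w≡y w∈))

    PF∩D : ∀ {u} → u ∈ PF → Sub.DVertex S u → (u ≡ x) ⊎ (u ≡ y)
    PF∩D (here u≡x) _ = inj₁ u≡x
    PF∩D (there u∈) d with ∈-++⁻ mF u∈
    ... | inj₁ u∈mF       = ⊥-elim (mF-fresh u∈mF d)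
    ... | inj₂ (here u≡y) = inj₂ u≡y

    PC-DVertex : ∀ {w} → w ∈ PC → Sub.DVertex S w
    PC-DVertex = boundary⇒DVertex ∘ PC⇒boundary

    mC≢[] : mC ≢ []
    mC≢[] mC≡[] =
      <-irrefl refl (subst (3 ≤_) (trans length-PC (cong (λ m → length m + 2) mC≡[])) boundary-length≥3)

    mF≢[] : mF ≢ []
    mF≢[] mF≡[] =
      <-irrefl refl (subst (3 ≤_) (trans length-PF (cong (λ m → length m + 2) mF≡[])) (facet-length F))

    boundary′ : List (Fin n)
    boundary′ = PC ++ mF

    lift : ∀ {u} → Sub.DVertex S u → Sub.DVertex (F ∷ S) u
    lift (i , i∈S , u∈i) = i , there i∈S , u∈i

    boundary′⇒DVertex : ∀ {u} → u ∈ boundary′ → Sub.DVertex (F ∷ S) u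
    boundary′⇒DVertex u∈ with ∈-++⁻ PC u∈
    ... | inj₁ u∈PC = lift (boundary⇒DVertex (PC⇒boundary u∈PC))
    ... | inj₂ u∈mF = F , here refl , PF⇒F (there (∈-++⁺ˡ u∈mF))

    DVertex⇒boundary′ : ∀ {u} → Sub.DVertex (F ∷ S) u → u ∈ boundary′
    DVertex⇒boundary′ (i , there i∈S , u∈i) = ∈-++⁺ˡ (boundary⇒PC (DVertex⇒boundary (i , i∈S , u∈i)))
    DVertex⇒boundary′ (_ , here refl , u∈F) = fromPF (F⇒PF u∈F)
      where
      fromPF : ∀ {u} → u ∈ PF → u ∈ boundary′
      fromPF (here refl) = ∈-++⁺ˡ (boundary⇒PC (DVertex⇒boundary (G , G∈S , proj₁ (FEdge-∈ eG))))
      fromPF (there u∈) with ∈-++⁻ mF u∈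
      ... | inj₁ u∈mF        = ∈-++⁺ʳ PC u∈mF
      ... | inj₂ (here refl) = ∈-++⁺ˡ (boundary⇒PC (DVertex⇒boundary (G , G∈S , proj₂ (FEdge-∈ eG))))

    boundary′-unique : Unique boundary′
    boundary′-unique = Unique.++⁺ PC-unique (Unique-++⁻ˡ mF (Unique-++⁻ʳ [ x ] PF-unique))
                         λ { (u∈PC , u∈mF) → mF-fresh u∈mF (boundary⇒DVertex (PC⇒boundary u∈PC)) }

    cycPairs-boundary′ : cycPairs boundary′ ≡ pairs PC ++ pairs PF
    cycPairs-boundary′ =
      trans (cong (λ z → pairs (y ∷ z)) (trans (++-assoc (mC ++ [ x ]) mF [ y ]) (++-assoc mC [ x ] (mF ++ [ y ]))))
            (sym (pairs-++ (y ∷ mC) x (mF ++ [ y ])))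

    boundary′-CycEdge⇔ : ∀ {u v} → CycEdge boundary′ u v ⇔ (PathEdge PC u v ⊎ PathEdge PF u v)
    boundary′-CycEdge⇔ = mk⇔ to from
      where
      split : ∀ {u v} → (u , v) ∈ cycPairs boundary′ → ((u , v) ∈ pairs PC) ⊎ ((u , v) ∈ pairs PF)
      split p = ∈-++⁻ (pairs PC) (subst (_ ∈_) cycPairs-boundary′ p)
      to : ∀ {u v} → CycEdge boundary′ u v → PathEdge PC u v ⊎ PathEdge PF u v
      to (inj₁ p) = Sum.map inj₁ inj₁ (split p)
      to (inj₂ p) = Sum.map inj₂ inj₂ (split p)
      inPC : ∀ {u v} → (u , v) ∈ pairs PC → (u , v) ∈ cycPairs boundary′
      inPC p = subst (_ ∈_) (sym cycPairs-boundary′) (∈-++⁺ˡ p)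
      inPF : ∀ {u v} → (u , v) ∈ pairs PF → (u , v) ∈ cycPairs boundary′
      inPF p = subst (_ ∈_) (sym cycPairs-boundary′) (∈-++⁺ʳ (pairs PC) p)
      from : ∀ {u v} → PathEdge PC u v ⊎ PathEdge PF u v → CycEdge boundary′ u v
      from (inj₁ e) = Sum.map inPC inPC e
      from (inj₂ e) = Sum.map inPF inPF e

    SameEdge-FEdge : ∀ {j u v a b} → FEdge j a b → SameEdge u v a b → FEdge j u v
    SameEdge-FEdge e (inj₁ (refl , refl)) = e
    SameEdge-FEdge e (inj₂ (refl , refl)) = FEdge-sym e

    BdEdge⇒boundary′ : ∀ {u v} → Sub.BdEdge (F ∷ S) u v → CycEdge boundary′ u v
    BdEdge⇒boundary′ (_ , here refl , e , only) with Equivalence.to (CutAt.edges cutF) e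
    ... | inj₁ pe   = Equivalence.from boundary′-CycEdge⇔ (inj₂ pe)
    ... | inj₂ same = ⊥-elim (F≢G (sym (only G (there G∈S) (SameEdge-FEdge (FEdge-sym eG) same))))
    BdEdge⇒boundary′ (i , there i∈S , e , only)
      with Equivalence.to (CutAt.edges cutC) (BdEdge⇒boundary (i , i∈S , e , λ j j∈S → only j (there j∈S)))
    ... | inj₁ pe   = Equivalence.from boundary′-CycEdge⇔ (inj₁ pe)
    ... | inj₂ same with only F (here refl) (SameEdge-FEdge eF same)
    ...   | refl = ⊥-elim (F∉S i∈S)

    boundary′⇒BdEdge : ∀ {u v} → CycEdge boundary′ u v → Sub.BdEdge (F ∷ S) u v
    boundary′⇒BdEdge {u} {v} ce with Equivalence.to boundary′-CycEdge⇔ ce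
    ... | inj₁ pe with boundary⇒BdEdge (Equivalence.from (CutAt.edges cutC) (inj₁ pe))
    ...   | i , i∈S , e , only = i , there i∈S , e , only′
      where
      only′ : ∀ j → j ∈ F ∷ S → FEdge j u v → j ≡ i
      only′ j (there j∈S) ej = only j j∈S ej
      only′ _ (here refl) ej = ⊥-elim (mC≢[] (PathEdge-joining-ends y mC x PC-unique pe
        (Sum.swap (PF∩D (F⇒PF (proj₁ (FEdge-∈ ej))) (PC-DVertex (proj₁ (PathEdge-∈ pe)))))
        (Sum.swap (PF∩D (F⇒PF (proj₂ (FEdge-∈ ej))) (PC-DVertex (proj₂ (PathEdge-∈ pe)))))))
    boundary′⇒BdEdge {u} {v} ce | inj₂ pe =
      F , here refl , Equivalence.from (CutAt.edges cutF) (inj₁ pe) , only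
      where
      only : ∀ j → j ∈ F ∷ S → FEdge j u v → j ≡ F
      only _ (here refl) _  = refl
      only j (there j∈S) ej = ⊥-elim (mF≢[] (PathEdge-joining-ends x mF y PF-unique pe
        (PF∩D (proj₁ (PathEdge-∈ pe)) (j , j∈S , proj₁ (FEdge-∈ ej)))
        (PF∩D (proj₂ (PathEdge-∈ pe)) (j , j∈S , proj₂ (FEdge-∈ ej)))))

    edges′ : List (Fin n × Fin n)
    edges′ = map sortPair (pairs PF) ++ edges

    liftEdge : ∀ {e} → Sub.DEdgeOrd S e → Sub.DEdgeOrd (F ∷ S) e
    liftEdge {_ , _} (u<v , i , i∈S , e) = u<v , i , there i∈S , e

    edges′⇒DEdgeOrd : ∀ {e} → e ∈ edges′ → Sub.DEdgeOrd (F ∷ S) e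
    edges′⇒DEdgeOrd e∈ with ∈-++⁻ (map sortPair (pairs PF)) e∈
    ... | inj₂ e∈edges = liftEdge (edges⇒DEdgeOrd e∈edges)
    ... | inj₁ e∈PF with ∈-map⁻ sortPair e∈PF
    ...   | (p , q) , pq∈ , refl =
      sortPair-< p q (pairs-distinct PF-unique pq∈) , F , here refl ,
      sortPair-preserves (FEdge F) FEdge-sym p q (Equivalence.from (CutAt.edges cutF) (inj₁ (inj₁ pq∈)))

    DEdgeOrd⇒edges′ : ∀ {e} → Sub.DEdgeOrd (F ∷ S) e → e ∈ edges′
    DEdgeOrd⇒edges′ {_ , _} (u<v , i , there i∈S , e) = ∈-++⁺ʳ _ (DEdgeOrd⇒edges (u<v , i , i∈S , e))
    DEdgeOrd⇒edges′ {u , v} (u<v , _ , here refl , e) with Equivalence.to (CutAt.edges cutF) e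
    ... | inj₁ (inj₁ uv∈) = ∈-++⁺ˡ (subst (_∈ _) (sortPair-sorted u v u<v) (∈-map⁺ sortPair uv∈))
    ... | inj₁ (inj₂ vu∈) = ∈-++⁺ˡ (subst (_∈ _) (sortPair-unsorted u v u<v) (∈-map⁺ sortPair vu∈))
    ... | inj₂ same       = ∈-++⁺ʳ _ (DEdgeOrd⇒edges (u<v , G , G∈S , SameEdge-FEdge (FEdge-sym eG) same))

    edges′-unique : Unique edges′
    edges′-unique = Unique.++⁺ (Unique-sortPair-pairs PF-unique) edges-unique disjoint
      where
      disjoint : ∀ {e} → ¬ (e ∈ map sortPair (pairs PF) × e ∈ edges)
      disjoint {u , v} (e∈PF , e∈edges) with edges⇒DEdgeOrd e∈edges | ∈-map⁻ sortPair e∈PF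
      ... | u<v , i , i∈S , e | (p , q) , pq∈ , eq
        with sortPair-≡⇒SameEdge p q u v (trans (sym eq) (sym (sortPair-sorted u v u<v)))
           | pairs-interior x mF y mF≢[] pq∈
      ... | inj₁ (refl , refl) | inj₁ p∈mF = mF-fresh p∈mF (i , i∈S , proj₁ (FEdge-∈ e))
      ... | inj₁ (refl , refl) | inj₂ q∈mF = mF-fresh q∈mF (i , i∈S , proj₂ (FEdge-∈ e))
      ... | inj₂ (refl , refl) | inj₁ p∈mF = mF-fresh p∈mF (i , i∈S , proj₂ (FEdge-∈ e))
      ... | inj₂ (refl , refl) | inj₂ q∈mF = mF-fresh q∈mF (i , i∈S , proj₁ (FEdge-∈ e))

    connected′ : ConnectedWithin (F ∷ S)
    connected′ (here refl) (here refl) = [ F ] , [] ∷ [] , one , here refl ∷ [] , refl , refl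
    connected′ (here refl) (there b∈S) with connected G∈S b∈S
    ... | G ∷ ps , u , ch , ps⊆S , refl , last≡b =
      F ∷ G ∷ ps , All.tabulate (λ z∈ F≡z → F∉S (subst (_∈ S) (sym F≡z) (All.lookup ps⊆S z∈))) ∷ u ,
      cons tFG ch , here refl ∷ All.map there ps⊆S , refl , last≡b
    connected′ (there a∈S) (here refl) with connected a∈S G∈S
    ... | a ∷ ps , u , ch , ps⊆S , refl , last≡G =
      (a ∷ ps) ++ [ F ] , Unique-∷ʳ⁺ u (F∉S ∘ All.lookup ps⊆S) ,
      Chain-∷ʳ ch last≡G (TE-sym tFG) , All.++⁺ (All.map there ps⊆S) (here refl ∷ []) ,
      refl , last-∷ʳ (a ∷ ps) F
    connected′ (there a∈S) (there b∈S) with connected a∈S b∈S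
    ... | ps , u , ch , ps⊆S , ends = ps , u , ch , All.map there ps⊆S , ends

    length-boundary′ : length boundary′ ≡ length boundary + length mF
    length-boundary′ = trans (length-++ PC) (cong (_+ length mF) (sym (↭-length (CutAt.vertices cutC))))

    length-edges′ : length edges′ ≡ suc (length mF) + length edges
    length-edges′ = begin
      length edges′                                      ≡⟨ length-++ (map sortPair (pairs PF)) ⟩
      length (map sortPair (pairs PF)) + length edges    ≡⟨ cong (_+ length edges) (length-map sortPair (pairs PF)) ⟩
      length (pairs PF) + length edges                   ≡⟨ cong (_+ length edges) (length-pairs x (mF ++ [ y ])) ⟩
      length (mF ++ [ y ]) + length edges                ≡⟨ cong (_+ length edges) (length-∷ʳ mF y) ⟩
      suc (length mF) + length edges                     ∎
      where open ≡-Reasoning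

    euler′ : length boundary′ + length (F ∷ S) ≡ length edges′ + 1
    euler′ = begin
      length boundary′ + suc s          ≡⟨ cong (_+ suc s) length-boundary′ ⟩
      (c + m) + suc s                   ≡⟨ euler-step c m s (length edges) euler ⟩
      (suc m + length edges) + 1        ≡⟨ cong (_+ 1) length-edges′ ⟨
      length edges′ + 1                 ∎
      where
      open ≡-Reasoning
      c = length boundary
      m = length mF
      s = length S

    boundary-length′ : length boundary′ + 2 * length (F ∷ S) ≡ sum (map (length ∘ face) (F ∷ S)) + 2
    boundary-length′ = begin
      length boundary′ + 2 * suc s      ≡⟨ cong (_+ 2 * suc s) length-boundary′ ⟩
      (c + m) + 2 * suc s               ≡⟨ boundary-length-step c m s σ boundary-length ⟩
      ((m + 2) + σ) + 2                 ≡⟨ cong (λ q → (q + σ) + 2) length-PF ⟨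
      (length (face F) + σ) + 2         ∎
      where
      open ≡-Reasoning
      c = length boundary
      m = length mF
      s = length S
      σ = sum (map (length ∘ face) S)

    attach : SubDisk (F ∷ S)
    attach = record
      { boundary          = boundary′
      ; edges             = edges′
      ; connected         = connected′
      ; boundary-unique   = boundary′-unique
      ; boundary-length≥3 = subst (3 ≤_) (sym length-boundary′) (≤-trans boundary-length≥3 (m≤m+n _ _))
      ; boundary⇒DVertex  = boundary′⇒DVertex
      ; DVertex⇒boundary  = DVertex⇒boundary′
      ; BdEdge⇒boundary   = BdEdge⇒boundary′
      ; boundary⇒BdEdge   = boundary′⇒BdEdge
      ; edges-unique      = edges′-unique
      ; edges⇒DEdgeOrd    = edges′⇒DEdgeOrd
      ; DEdgeOrd⇒edges    = DEdgeOrd⇒edges′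
      ; euler             = euler′
      ; boundary-length   = boundary-length′
      }

  SubDisk-resp-↭ : ∀ {S S′} → S ↭ S′ → SubDisk S → SubDisk S′
  SubDisk-resp-↭ {S} {S′} p D = record
    { boundary          = boundary
    ; edges             = edges
    ; connected         = λ a∈ b∈ → let ps , u , ch , ps⊆ , ends = connected (⇐ a∈) (⇐ b∈)
                                    in ps , u , ch , All.map ⇒ ps⊆ , ends
    ; boundary-unique   = boundary-unique
    ; boundary-length≥3 = boundary-length≥3
    ; boundary⇒DVertex  = λ u∈ → let i , i∈ , u∈i = boundary⇒DVertex u∈ in i , ⇒ i∈ , u∈i
    ; DVertex⇒boundary  = λ { (i , i∈ , u∈i) → DVertex⇒boundary (i , ⇐ i∈ , u∈i) }
    ; BdEdge⇒boundary   = λ { (i , i∈ , e , only) → BdEdge⇒boundary (i , ⇐ i∈ , e , λ j → only j ∘ ⇒) }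
    ; boundary⇒BdEdge   = λ e → let i , i∈ , eᵢ , only = boundary⇒BdEdge e
                                 in i , ⇒ i∈ , eᵢ , λ j → only j ∘ ⇐
    ; edges-unique      = edges-unique
    ; edges⇒DEdgeOrd    = λ { {_ , _} e∈ → let u<v , i , i∈ , e = edges⇒DEdgeOrd e∈
                                             in u<v , i , ⇒ i∈ , e }
    ; DEdgeOrd⇒edges    = λ { {_ , _} (u<v , i , i∈ , e) → DEdgeOrd⇒edges (u<v , i , ⇐ i∈ , e) }
    ; euler             = subst (λ k → length boundary + k ≡ length edges + 1) (↭-length p) euler
    ; boundary-length   = subst₂ (λ k σ → length boundary + 2 * k ≡ σ + 2)
                                 (↭-length p) (sum-↭ (map⁺ (length ∘ face) p)) boundary-length
    }
    where
    open SubDisk D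
    ⇒ : ∀ {i} → i ∈ S → i ∈ S′
    ⇒ = ∈-resp-↭ p
    ⇐ : ∀ {i} → i ∈ S′ → i ∈ S
    ⇐ = ∈-resp-↭ (↭-sym p)

  private
    attachable : ∀ {S r R s} → S ++ r ∷ R ↭ vs → s ∈ S →
                 ∃₂ λ F G → F ∈ r ∷ R × F ∉ S × G ∈ S × TE F G
    attachable {S} {r} {R} p s∈S
      with tree-connected _ r (∈-resp-↭ p (∈-++⁺ˡ s∈S)) (∈-resp-↭ p (∈-++⁺ʳ S (here refl)))
    ... | _ , walk , ends
      with Chain-exit (_∈? S) walk ends s∈S (Unique-++⇒∉ S (Unique-resp-↭ (↭-sym p) distinct) (here refl))
    ... | G , F , tGF , G∈S , F∉S with ∈-++⁻ S (∈-resp-↭ (↭-sym p) (proj₁ (proj₂ (TE-endpoints tGF))))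
    ...   | inj₁ F∈S   = ⊥-elim (F∉S F∈S)
    ...   | inj₂ F∈r∷R = F , G , F∈r∷R , F∉S , G∈S , TE-sym tGF

    grow : ∀ m (S R : List (Fin f)) → length R ≡ m → S ++ R ↭ vs → SubDisk S → ∀ {s} → s ∈ S → SubDisk vs
    grow zero    S []      _   p D _   = SubDisk-resp-↭ (↭-trans (↭-reflexive (sym (++-identityʳ S))) p) D
    grow (suc m) S (r ∷ R) len p D s∈S with attachable p s∈S
    ... | F , G , F∈r∷R , F∉S , G∈S , tFG with ∈⇒↭∷ F∈r∷R
    ...   | R′ , R↭ = grow m (F ∷ S) R′ len′ p′ (Attach.attach D S⊆vs F∈vs F∉S G∈S tFG) (there s∈S)
      where
      len′ : length R′ ≡ m
      len′ = suc-injective (trans (sym (↭-length R↭)) len)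
      p′ : (F ∷ S) ++ R′ ↭ vs
      p′ = ↭-trans (↭-sym (↭-trans (++⁺ˡ S R↭) (shift F S R′))) p
      S⊆vs : ∀ {i} → i ∈ S → i ∈ vs
      S⊆vs = ∈-resp-↭ p ∘ ∈-++⁺ˡ
      F∈vs : F ∈ vs
      F∈vs = proj₁ (TE-endpoints tFG)

  subDisk : SubDisk vs
  subDisk = start vs ↭-refl nonempty
    where
    start : ∀ xs → xs ↭ vs → 1 ≤ length xs → SubDisk vs
    start (v ∷ t) p _ = grow (length t) [ v ] t refl p (singleFacet v) (here refl)

  open SubDisk subDisk

  boundary-length≡n : (∀ i → Count (AdjM i) (deg i)) → length boundary ≡ n
  boundary-length≡n degrees = cancel-doubled (length boundary) n k (begin
    length boundary + 2 * suc k          ≡⟨ cong (λ l → length boundary + 2 * l) length-vs ⟨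
    length boundary + 2 * length vs      ≡⟨ boundary-length ⟩
    sum (map (length ∘ face) vs) + 2     ≡⟨ cong (λ l → sum l + 2) (map-cong facet-degree vs) ⟩
    sum (map deg vs) + 2                 ≡⟨ cong (_+ 2) cond1 ⟩
    (n + 2 * (length vs ∸ 1)) + 2        ≡⟨ cong (λ l → (n + 2 * (l ∸ 1)) + 2) length-vs ⟩
    (n + 2 * k) + 2                      ∎)
    where
    open ≡-Reasoning
    facet-degree : ∀ i → length (face i) ≡ deg i
    facet-degree i = Count-unique (AdjM-count i) (degrees i)
    positive : ∀ xs → 1 ≤ length xs → ∃[ k ] length xs ≡ suc k
    positive (_ ∷ xs) _ = length xs , refl
    k = proj₁ (positive vs nonempty)
    length-vs : length vs ≡ suc k
    length-vs = proj₂ (positive vs nonempty)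

  isDisk : Sub.IsDisk vs
  isDisk = record
    { faceConnected    = λ i j i∈ j∈ → let walk , ch , ends = tree-connected i j i∈ j∈
                                       in walk , Chain-map TE-endpoints ch , ends
    ; linkConnected    = λ u i j i∈ j∈ u∈i u∈j → let walk , _ , ch , ends = cond2 u i j i∈ j∈ u∈i u∈j
                                                 in walk , Chain-map aroundVertex ch , ends
    ; boundaryNonempty = let u , v , e = CycEdge-exists boundary (≤-trans (s≤s (s≤s z≤n)) boundary-length≥3)
                         in u , v , boundary⇒BdEdge e
    ; euler            = length boundary , length edges
                       , (boundary , boundary-unique , (λ _ → mk⇔ boundary⇒DVertex DVertex⇒boundary) , refl)
                       , (edges , edges-unique , (λ _ → mk⇔ edges⇒DEdgeOrd DEdgeOrd⇒edges) , refl)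
                       , euler
    }
    where
    aroundVertex : ∀ {u a b} → TE a b × LinkAdj u a b → (a ∈ vs) × (b ∈ vs) × LinkAdj u a b
    aroundVertex (t , l) = proj₁ (TE-endpoints t) , proj₁ (proj₂ (TE-endpoints t)) , l

  boundaryHamiltonian : (∀ i → Count (AdjM i) (deg i)) → Sub.BoundaryHamiltonian vs
  boundaryHamiltonian degrees =
    boundary , (boundary-length≥3 , boundary-unique , inEG) , boundary-length≡n degrees ,
    λ _ _ → mk⇔ BdEdge⇒boundary boundary⇒BdEdge
    where
    inEG : ∀ u v → CycEdge boundary u v → EGK u v
    inEG u v e = let i , _ , eᵢ , _ = boundary⇒BdEdge e in i , eᵢ

lemma6 : (n f : ℕ) (face : Fin f → List (Fin n)) →
    Map.IsPolyhedralMap face →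
    (deg : Fin f → ℕ) → (∀ i → Count (Map.AdjM face i) (deg i)) →
    (vs : List (Fin f)) (es : List (Fin f × Fin f)) →
    Map.IsProperTree face deg vs es →
    Map.Sub.IsDisk face vs × Map.Sub.BoundaryHamiltonian face vs
lemma6 n f face PM deg degrees vs es PT = isDisk , boundaryHamiltonian degrees
  where open ProperTree PM PT
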